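{- For every finite loopless multigraph $G$, $\max(\Delta(G), \omega(G)) \leq \tau(G) \leq \chi'(G)$.
   Context: All multigraphs are finite and loopless (parallel edges allowed). For a multigraph $G=(V,E)$, $\Delta(G)$ is the maximum vertex degree and $\deg_G(x)$ the degree of $x$. For $S\subseteq V$, $E(S)$ denotes the multiset of edges with both endpoints in $S$. The chromatic index $\chi'(G)$ is the minimum number of colors needed to color the edges so that no two edges sharing an endpoint get the same color. The density is $\omega(G)=\max_{H}\left\lceil \frac{e(H)}{\lfloor v(H)/2\rfloor}\right\rceil$, the maximum over sub-multigraphs $H\subseteq G$ with $v(H)\ge 2$ vertices, where $e(H)$ is the number of edges of $H$. A degree-coloring of $G$ with $c$ colors is a map $\mu: V\to 2^{\{1,\dots,c\}}$ such that (degree condition) $|\mu(x)|=\deg_G(x)$ for every $x\in V$, and (cover condition) for every $S\subseteq V$, $|E(S)|\le \sum_{i=1}^{c}\left\lfloor \frac{|S^{(i)}(\mu)|}{2}\right\rfloor$, where $S^{(i)}(\mu)=\{x\in S: i\in\mu(x)\}$. The degree-coloring index $\tau(G)$ is the smallest integer $c$ for which a degree-coloring of $G$ with $c$ colors exists. -}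

module Defs where

open import Data.Nat using (ℕ; zero; suc; _+_; _≤_; _⊔_; ⌊_/2⌋; _/_)
open import Data.Bool using (Bool; true; false; _∧_; _∨_)
open import Data.Fin using (Fin; _≟_)
open import Data.Fin.Subset using (Subset; _∈_; ∣_∣)
open import Data.Vec using (Vec; tabulate; lookup)
open import Data.List using (List; foldr; map; allFin)
open import Data.Product using (_×_; proj₁; proj₂; Σ)
open import Relation.Binary.PropositionalEquality using (_≡_; _≢_)
open import Relation.Nullary using (does)

-- A finite loopless multigraph: vertex set Fin n, edge set Fin m
-- (edges are labelled, so parallel edges are allowed), each edge has
-- two distinct endpoints.
record Multigraph : Set where
  field
    n        : ℕ
    m        : ℕ
    ends     : Fin m → Fin n × Fin n
    loopless : ∀ e → proj₁ (ends e) ≢ proj₂ (ends e)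

module _ (G : Multigraph) where
  open Multigraph G

  incident : Fin n → Fin m → Bool
  incident x e = does (x ≟ proj₁ (ends e)) ∨ does (x ≟ proj₂ (ends e))

  deg : Fin n → ℕ
  deg x = ∣ tabulate (incident x) ∣

  Δ : ℕ
  Δ = foldr _⊔_ 0 (map deg (allFin n))

  inside : Subset n → Subset m
  inside S = tabulate (λ e → lookup S (proj₁ (ends e)) ∧ lookup S (proj₂ (ends e)))

  record SubMultigraph : Set where
    field
      verts : Subset n
      edges : Subset m
      closed : ∀ e → e ∈ edges → proj₁ (ends e) ∈ verts × proj₂ (ends e) ∈ verts

  v[_] : SubMultigraph → ℕ
  v[ H ] = ∣ SubMultigraph.verts H ∣

  e[_] : SubMultigraph → ℕ
  e[ H ] = ∣ SubMultigraph.edges H ∣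

-- ceiling division ⌈ a / b ⌉ (b = 0 gives 0; never used with b = 0)
⌈_/_⌉ : ℕ → ℕ → ℕ
⌈ a / zero ⌉  = 0
⌈ a / suc k ⌉ = (a + k) / suc k

-- "ω(G) ≤ c": every sub-multigraph H with v(H) ≥ 2 satisfies
-- ⌈ e(H) / ⌊ v(H)/2 ⌋ ⌉ ≤ c  (unfolding of  max_H ... ≤ c)
ω≤ : Multigraph → ℕ → Set
ω≤ G c = ∀ (H : SubMultigraph G) → 2 ≤ v[_] G H →
           ⌈ e[_] G H / ⌊ v[_] G H /2⌋ ⌉ ≤ c

Σ< : (c : ℕ) → (Fin c → ℕ) → ℕ
Σ< c f = foldr _+_ 0 (map f (allFin c))

record DegreeColoring (G : Multigraph) (c : ℕ) : Set where
  open Multigraph G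
  field
    μ : Fin n → Subset c
    degreeCond : ∀ x → ∣ μ x ∣ ≡ deg G x
    coverCond  : ∀ (S : Subset n) →
      ∣ inside G S ∣ ≤ Σ< c (λ i → ⌊ ∣ tabulate (λ x → lookup S x ∧ lookup (μ x) i) ∣ /2⌋)

record EdgeColoring (G : Multigraph) (c : ℕ) : Set where
  open Multigraph G
  field
    col : Fin m → Fin c
    proper : ∀ e f → e ≢ f → (x : Fin n) → incident G x e ≡ true → incident G x f ≡ true →
             col e ≢ col f

IsLeast : (ℕ → Set) → ℕ → Set
IsLeast P k = P k × (∀ c → P c → k ≤ c)

-- Give each vertex of a properly edge-coloured multigraph the set of colours
-- on its edges. Inside a vertex set S the edges of colour i form a matching
-- whose endpoints all carry colour i, so double counting edge–endpoint
-- incidences shows there are at most ⌊|S⁽ⁱ⁾|/2⌋ of them: this is a degree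
-- colouring, hence τ ≤ χ'. Conversely, in a degree colouring with c colours
-- every vertex has at most c colours, so Δ ≤ c, and the cover condition for
-- the vertex set of H gives e(H) ≤ c ⌊v(H)/2⌋, so ω ≤ c. The least τ exists
-- because degree colourings with c colours range over a finite search space.
module Submission where

open import Defs
open import Data.Bool using (Bool; true; false; _∧_; _∨_)
open import Data.Bool.Properties using (∧-conicalˡ; ∧-conicalʳ; ¬-not)
import Data.Bool.Properties as Bool
open import Data.Empty using (⊥-elim)
open import Data.Fin using (Fin; zero; suc; _≟_)
open import Data.Fin.Properties using (any?; all?; suc-injective)
open import Data.Fin.Subset using (Subset; _∈_; ∣_∣)
open import Data.Fin.Subset.Properties using (anySubset?; ∣p∣≤n)
open import Data.List using (List; []; _∷_; foldr; map; allFin)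
import Data.List as List
import Data.List.Properties as List
open import Data.Nat using (ℕ; zero; suc; _+_; _*_; _≤_; _<_; _⊔_; ⌊_/2⌋; z≤n; s≤s; _≤?_)
import Data.Nat as ℕ
open import Data.Nat.DivMod using (m<n*o⇒m/o<n)
open import Data.Nat.Properties hiding (_≟_; suc-injective)
open import Data.Product using (Σ; ∃; _×_; _,_; proj₁; proj₂)
open import Data.Sum using (_⊎_; inj₁; inj₂; [_,_]′)
open import Data.Vec using (Vec; []; _∷_; lookup; tabulate)
open import Data.Vec.Properties using (lookup∘tabulate; tabulate∘lookup; tabulate-cong; []=⇒lookup; lookup⇒[]=)
open import Function using (_∘_; id)
open import Level using (0ℓ)
open import Relation.Binary.PropositionalEquality
open import Relation.Nullary using (Dec; yes; no; does; ¬_; contradiction)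
open import Relation.Nullary.Decidable using (_×-dec_; ¬?; map′; dec-true; decidable-stable)
open import Relation.Unary using (Pred; Decidable)
open import Algebra.Properties.Semiring.Sum +-*-semiring
  using (sum; sum-syntax; sum-cong-≗; sum-replicate-zero; ∑-comm; ∑-distrib-+; *-distribˡ-sum)

does-true : ∀ {A : Set} (a? : Dec A) → does a? ≡ true → A
does-true (yes a) _ = a

∑-mono-≤ : ∀ {k} {f g : Fin k → ℕ} → (∀ i → f i ≤ g i) → sum f ≤ sum g
∑-mono-≤ {zero}  f≤g = z≤n
∑-mono-≤ {suc k} f≤g = +-mono-≤ (f≤g zero) (∑-mono-≤ (f≤g ∘ suc))

∑-≤-* : ∀ {k b} {f : Fin k → ℕ} → (∀ i → f i ≤ b) → sum f ≤ k * b
∑-≤-* {zero}  f≤b = z≤n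
∑-≤-* {suc k} f≤b = +-mono-≤ (f≤b zero) (∑-≤-* (f≤b ∘ suc))

Σ<≡∑ : ∀ c (f : Fin c → ℕ) → Σ< c f ≡ sum f
Σ<≡∑ c f = trans (cong (foldr _+_ 0) (List.map-tabulate id f)) (foldr-tabulate f)
  where
  foldr-tabulate : ∀ {k} (g : Fin k → ℕ) → foldr _+_ 0 (List.tabulate g) ≡ sum g
  foldr-tabulate {zero}  g = refl
  foldr-tabulate {suc k} g = cong (g zero +_) (foldr-tabulate (g ∘ suc))

foldr-⊔-lub : ∀ {A : Set} {b} (f : A → ℕ) (xs : List A) → (∀ x → f x ≤ b) → foldr _⊔_ 0 (map f xs) ≤ b
foldr-⊔-lub f []       f≤b = z≤n
foldr-⊔-lub f (x ∷ xs) f≤b = ⊔-lub (f≤b x) (foldr-⊔-lub f xs f≤b)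

≤⌊/2⌋ : ∀ {a b} → 2 * a ≤ b → a ≤ ⌊ b /2⌋
≤⌊/2⌋ {a} {b} 2a≤b = subst (_≤ ⌊ b /2⌋) (sym (n≡⌊n+n/2⌋ a))
  (⌊n/2⌋-mono (subst (_≤ b) (cong (a +_) (+-identityʳ a)) 2a≤b))

⌈/⌉≤ : ∀ {a b c} → 1 ≤ b → a ≤ c * b → ⌈ a / b ⌉ ≤ c
⌈/⌉≤ {a} {suc b} {c} _ a≤cb = ≤-pred (m<n*o⇒m/o<n (s≤s (begin
  a + b             ≤⟨ +-monoˡ-≤ b a≤cb ⟩
  c * suc b + b     ≡⟨ +-comm (c * suc b) b ⟩
  b + c * suc b     ∎)))
  where open ≤-Reasoning

toℕ : Bool → ℕ
toℕ false = 0
toℕ true  = 1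

count : ∀ {k} → (Fin k → Bool) → ℕ
count {k} f = ∑[ i < k ] toℕ (f i)

any : ∀ {k} → (Fin k → Bool) → Bool
any f = does (any? λ i → f i Bool.≟ true)

AtMostOne : ∀ {k} → (Fin k → Bool) → Set
AtMostOne f = ∀ i j → f i ≡ true → f j ≡ true → i ≡ j

∣tabulate∣≡count : ∀ {k} (f : Fin k → Bool) → ∣ tabulate f ∣ ≡ count f
∣tabulate∣≡count {zero}  f = refl
∣tabulate∣≡count {suc k} f with f zero
... | true  = cong suc (∣tabulate∣≡count (f ∘ suc))
... | false = ∣tabulate∣≡count (f ∘ suc)

∣p∣≡count : ∀ {k} (p : Subset k) → ∣ p ∣ ≡ count (lookup p)
∣p∣≡count p = trans (cong ∣_∣ (sym (tabulate∘lookup p))) (∣tabulate∣≡count (lookup p))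

count-mono : ∀ {k} {f g : Fin k → Bool} → (∀ i → f i ≡ true → g i ≡ true) → count f ≤ count g
count-mono f⇒g = ∑-mono-≤ (λ i → toℕ-mono (f⇒g i))
  where
  toℕ-mono : ∀ {a b} → (a ≡ true → b ≡ true) → toℕ a ≤ toℕ b
  toℕ-mono {false} _   = z≤n
  toℕ-mono {true}  a⇒b rewrite a⇒b refl = ≤-refl

count-none : ∀ {k} {f : Fin k → Bool} → (∀ i → f i ≡ false) → count f ≡ 0
count-none {k} f≡false = trans (sum-cong-≗ (cong toℕ ∘ f≡false)) (sum-replicate-zero k)

count-∨ : ∀ {k} {f g : Fin k → Bool} → (∀ i → f i ∧ g i ≡ false) →
          count (λ i → f i ∨ g i) ≡ count f + count g
count-∨ {f = f} {g} disjoint =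
  trans (sum-cong-≗ λ i → toℕ-∨ {f i} {g i} (disjoint i)) (∑-distrib-+ (toℕ ∘ f) (toℕ ∘ g))
  where
  toℕ-∨ : ∀ {a b} → a ∧ b ≡ false → toℕ (a ∨ b) ≡ toℕ a + toℕ b
  toℕ-∨ {true}  {false} _ = refl
  toℕ-∨ {false} {_}     _ = refl

count-singleton : ∀ {k} (j : Fin k) → count (λ i → does (i ≟ j)) ≡ 1
count-singleton {suc k} zero    = cong suc (count-none {k} {λ i → does (suc i ≟ zero)} λ _ → refl)
count-singleton {suc k} (suc j) = count-singleton j

count-pos : ∀ {k} {f : Fin k → Bool} i → f i ≡ true → 1 ≤ count f
count-pos           zero    fi rewrite fi = s≤s z≤n
count-pos {f = f} (suc i) fi = ≤-trans (count-pos i fi) (m≤n+m _ (toℕ (f zero)))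

count≤1 : ∀ {k} {f : Fin k → Bool} → AtMostOne f → count f ≤ 1
count≤1 {zero}      _      = z≤n
count≤1 {suc k} {f} unique with f zero in f0
... | true  = ≤-reflexive (cong suc (count-none rest))
  where
  rest : ∀ i → f (suc i) ≡ false
  rest i = ¬-not λ fi → contradiction (unique zero (suc i) f0 fi) λ ()
... | false = count≤1 λ i j fi fj → suc-injective (unique (suc i) (suc j) fi fj)

count≤toℕ : ∀ {k} {f : Fin k → Bool} {b} → AtMostOne f → (∀ i → f i ≡ true → b ≡ true) → count f ≤ toℕ b
count≤toℕ {b = true}  unique _   = count≤1 unique
count≤toℕ {b = false} _      f⇒b = ≤-reflexive (count-none λ i → ¬-not λ fi → contradiction (f⇒b i fi) λ ())

count≡toℕ∘any : ∀ {k} {f : Fin k → Bool} → AtMostOne f → count f ≡ toℕ (any f)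
count≡toℕ∘any {f = f} unique with any? (λ i → f i Bool.≟ true)
... | yes (i , fi) = ≤-antisym (count≤1 unique) (count-pos i fi)
... | no ∄        = count-none λ i → ¬-not λ fi → ∄ (i , fi)

count-partition : ∀ {m c} (col : Fin m → Fin c) (P : Fin m → Bool) →
                  count P ≡ ∑[ i < c ] count (λ e → P e ∧ does (i ≟ col e))
count-partition {c = c} col P = trans (sum-cong-≗ split) (∑-comm λ e i → toℕ (P e ∧ does (i ≟ col e)))
  where
  split : ∀ e → toℕ (P e) ≡ count (λ i → P e ∧ does (i ≟ col e))
  split e with P e
  ... | true  = sym (count-singleton (col e))
  ... | false = sym (count-none {c} λ _ → refl)

∀-Subset? : ∀ {k} {P : Pred (Subset k) 0ℓ} → Decidable P → Dec (∀ p → P p)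
∀-Subset? P? = map′ (λ ∄ p → decidable-stable (P? p) λ ¬Pp → ∄ (p , ¬Pp))
                    (λ ∀P (p , ¬Pp) → ¬Pp (∀P p))
                    (¬? (anySubset? (¬? ∘ P?)))

Search : Set → Set₁
Search A = ∀ {P : Pred A 0ℓ} → Decidable P → Dec (∃ P)

∃-Vec? : ∀ {A : Set} → Search A → ∀ n → Search (Vec A n)
∃-Vec? search zero    P? = map′ ([] ,_) (λ { ([] , p) → p }) (P? [])
∃-Vec? search (suc n) P? =
  map′ (λ (a , v , p) → a ∷ v , p) (λ { (a ∷ v , p) → a , v , p })
       (search λ a → ∃-Vec? search n (P? ∘ (a ∷_)))

least-below : ∀ {P : Pred ℕ 0ℓ} → Decidable P → ∀ k → ∃ (IsLeast P) ⊎ (∀ {c} → c < k → ¬ P c)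
least-below P? zero = inj₂ λ ()
least-below P? (suc k) with least-below P? k
... | inj₁ least = inj₁ least
... | inj₂ none with P? k
...   | yes Pk  = inj₁ (k , Pk , λ c Pc → ≮⇒≥ λ c<k → none c<k Pc)
...   | no  ¬Pk = inj₂ λ c<1+k → [ none , (λ { refl → ¬Pk }) ]′ (m<1+n⇒m<n∨m≡n c<1+k)

least-exists : ∀ {P : Pred ℕ 0ℓ} → Decidable P → ∀ {k} → P k → ∃ (IsLeast P)
least-exists P? {k} Pk = [ id , (λ none → contradiction Pk (none ≤-refl)) ]′ (least-below P? (suc k))

module _ (G : Multigraph) where
  open Multigraph G

  IsMatching : (Fin m → Bool) → Set
  IsMatching Q = ∀ x → AtMostOne (λ e → Q e ∧ incident G x e)

  count-endpoints : ∀ e → count (λ x → incident G x e) ≡ 2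
  count-endpoints e = trans (count-∨ distinct)
    (cong₂ _+_ (count-singleton (proj₁ (ends e))) (count-singleton (proj₂ (ends e))))
    where
    distinct : ∀ x → does (x ≟ proj₁ (ends e)) ∧ does (x ≟ proj₂ (ends e)) ≡ false
    distinct x with x ≟ proj₁ (ends e) | x ≟ proj₂ (ends e)
    ... | yes x≡u | yes x≡v = ⊥-elim (loopless e (trans (sym x≡u) x≡v))
    ... | yes _   | no _    = refl
    ... | no _    | _       = refl

  endpoint-∈ : (P : Fin n → Bool) → ∀ {e x} → P (proj₁ (ends e)) ∧ P (proj₂ (ends e)) ≡ true →
               incident G x e ≡ true → P x ≡ true
  endpoint-∈ P {e} {x} both x∈e with x ≟ proj₁ (ends e) | x ≟ proj₂ (ends e)
  ... | yes refl | _        = ∧-conicalˡ _ _ both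
  ... | no _     | yes refl = ∧-conicalʳ _ _ both

  -- Each edge of Q is counted twice, once at each endpoint, and each vertex
  -- of T is the endpoint of at most one edge of Q.
  matching-bound : ∀ (Q : Fin m → Bool) (T : Fin n → Bool) → IsMatching Q →
                   (∀ e x → Q e ∧ incident G x e ≡ true → T x ≡ true) → 2 * count Q ≤ count T
  matching-bound Q T matching covered = begin
    2 * count Q                                        ≡⟨ *-distribˡ-sum 2 (toℕ ∘ Q) ⟩
    ∑[ e < m ] (2 * toℕ (Q e))                         ≡⟨ sum-cong-≗ incidences ⟩
    ∑[ e < m ] ∑[ x < n ] toℕ (Q e ∧ incident G x e)   ≡⟨ ∑-comm (λ e x → toℕ (Q e ∧ incident G x e)) ⟩
    ∑[ x < n ] count (λ e → Q e ∧ incident G x e)      ≤⟨ ∑-mono-≤ (λ x → count≤toℕ (matching x) (λ e → covered e x)) ⟩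
    count T                                            ∎
    where
    open ≤-Reasoning
    incidences : ∀ e → 2 * toℕ (Q e) ≡ count (λ x → Q e ∧ incident G x e)
    incidences e with Q e
    ... | true  = sym (count-endpoints e)
    ... | false = sym (count-none {n} λ _ → refl)

module _ (G : Multigraph) (c : ℕ) where
  open Multigraph G

  coverBound : (Fin n → Subset c) → Subset n → ℕ
  coverBound μ S = Σ< c (λ i → ⌊ ∣ tabulate (λ x → lookup S x ∧ lookup (μ x) i) ∣ /2⌋)

  IsDegreeColoring : (Fin n → Subset c) → Set
  IsDegreeColoring μ = (∀ x → ∣ μ x ∣ ≡ deg G x) × (∀ S → ∣ inside G S ∣ ≤ coverBound μ S)

  isDegreeColoring? : Decidable IsDegreeColoring
  isDegreeColoring? μ = all? (λ x → ∣ μ x ∣ ℕ.≟ deg G x) ×-dec ∀-Subset? (λ S → ∣ inside G S ∣ ≤? coverBound μ S)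

  coverBound-cong : ∀ {μ μ′} → (∀ x → μ x ≡ μ′ x) → ∀ S → coverBound μ S ≡ coverBound μ′ S
  coverBound-cong μ≗μ′ S = trans (Σ<≡∑ c _) (trans
    (sum-cong-≗ λ i → cong (λ p → ⌊ ∣ p ∣ /2⌋) (tabulate-cong λ x → cong (λ μx → lookup S x ∧ lookup μx i) (μ≗μ′ x)))
    (sym (Σ<≡∑ c _)))

  IsDegreeColoring-resp : ∀ {μ μ′} → (∀ x → μ x ≡ μ′ x) → IsDegreeColoring μ → IsDegreeColoring μ′
  IsDegreeColoring-resp μ≗μ′ (degree , cover) =
    (λ x → trans (cong ∣_∣ (sym (μ≗μ′ x))) (degree x)) ,
    (λ S → subst (∣ inside G S ∣ ≤_) (coverBound-cong μ≗μ′ S) (cover S))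

  degreeColoring? : Dec (DegreeColoring G c)
  degreeColoring? = map′
    (λ (v , degree , cover) → record { μ = lookup v ; degreeCond = degree ; coverCond = cover })
    (λ d → let open DegreeColoring d in
      tabulate μ , IsDegreeColoring-resp (λ x → sym (lookup∘tabulate μ x)) (degreeCond , coverCond))
    (∃-Vec? anySubset? n (isDegreeColoring? ∘ lookup))

module _ {G : Multigraph} {c : ℕ} (ec : EdgeColoring G c) where
  open Multigraph G
  open EdgeColoring ec

  colouredAt : Fin n → Fin c → Fin m → Bool
  colouredAt x i e = incident G x e ∧ does (i ≟ col e)

  colouredAt-unique : ∀ x i → AtMostOne (colouredAt x i)
  colouredAt-unique x i e f xie xif = decidable-stable (e ≟ f) λ e≢f →
    proper e f e≢f x (∧-conicalˡ _ _ xie) (∧-conicalˡ _ _ xif)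
      (trans (sym (does-true (i ≟ col e) (∧-conicalʳ _ _ xie))) (does-true (i ≟ col f) (∧-conicalʳ _ _ xif)))

  colours : Fin n → Subset c
  colours x = tabulate λ i → any (colouredAt x i)

  colours-present : ∀ x i e → colouredAt x i e ≡ true → lookup (colours x) i ≡ true
  colours-present x i e xie = trans (lookup∘tabulate _ i) (dec-true (any? _) (e , xie))

  colours-degree : ∀ x → ∣ colours x ∣ ≡ deg G x
  colours-degree x = begin
    ∣ colours x ∣                            ≡⟨ ∣tabulate∣≡count (λ i → any (colouredAt x i)) ⟩
    count (λ i → any (colouredAt x i))       ≡⟨ sum-cong-≗ (λ i → count≡toℕ∘any (colouredAt-unique x i)) ⟨
    ∑[ i < c ] count (colouredAt x i)        ≡⟨ count-partition col (incident G x) ⟨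
    count (incident G x)                     ≡⟨ ∣tabulate∣≡count (incident G x) ⟨
    deg G x                                  ∎
    where open ≡-Reasoning

  module _ (S : Subset n) where

    insideS : Fin m → Bool
    insideS e = lookup S (proj₁ (ends e)) ∧ lookup S (proj₂ (ends e))

    covered : Fin c → Fin n → Bool
    covered i x = lookup S x ∧ lookup (colours x) i

    colourClass : Fin c → Fin m → Bool
    colourClass i e = insideS e ∧ does (i ≟ col e)

    colourClass-at : ∀ i e x → colourClass i e ∧ incident G x e ≡ true →
                     insideS e ≡ true × colouredAt x i e ≡ true
    colourClass-at i e x h with insideS e | does (i ≟ col e) | incident G x e
    colourClass-at i e x refl | true | true | true = refl , refl

    colourClass-matching : ∀ i → IsMatching G (colourClass i)
    colourClass-matching i x e f ie if =
      colouredAt-unique x i e f (proj₂ (colourClass-at i e x ie)) (proj₂ (colourClass-at i f x if))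

    colourClass-covered : ∀ i e x → colourClass i e ∧ incident G x e ≡ true →
                          covered i x ≡ true
    colourClass-covered i e x h = cong₂ _∧_
      (endpoint-∈ G (lookup S) inS (∧-conicalˡ (incident G x e) (does (i ≟ col e)) coloured))
      (colours-present x i e coloured)
      where
      inS : insideS e ≡ true
      inS = proj₁ (colourClass-at i e x h)
      coloured : colouredAt x i e ≡ true
      coloured = proj₂ (colourClass-at i e x h)

    colourClass-bound : ∀ i → count (colourClass i) ≤ ⌊ count (covered i) /2⌋
    colourClass-bound i =
      ≤⌊/2⌋ (matching-bound G (colourClass i) (covered i) (colourClass-matching i) (colourClass-covered i))

    colours-cover : ∣ inside G S ∣ ≤ coverBound G c colours S
    colours-cover = begin
      ∣ inside G S ∣                             ≡⟨ ∣tabulate∣≡count insideS ⟩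
      count insideS                              ≡⟨ count-partition col insideS ⟩
      ∑[ i < c ] count (colourClass i)           ≤⟨ ∑-mono-≤ colourClass-bound ⟩
      ∑[ i < c ] ⌊ count (covered i) /2⌋         ≡⟨ sum-cong-≗ (cong ⌊_/2⌋ ∘ ∣tabulate∣≡count ∘ covered) ⟨
      ∑[ i < c ] ⌊ ∣ tabulate (covered i) ∣ /2⌋  ≡⟨ Σ<≡∑ c _ ⟨
      coverBound G c colours S                   ∎
      where open ≤-Reasoning

  edgeColoring⇒degreeColoring : DegreeColoring G c
  edgeColoring⇒degreeColoring = record
    { μ = colours ; degreeCond = colours-degree ; coverCond = colours-cover }

module _ {G : Multigraph} {c : ℕ} (dc : DegreeColoring G c) where
  open Multigraph G
  open DegreeColoring dc

  degreeColoring⇒Δ≤ : Δ G ≤ c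
  degreeColoring⇒Δ≤ = foldr-⊔-lub (deg G) (allFin n) λ x → subst (_≤ c) (degreeCond x) (∣p∣≤n (μ x))

  degreeColoring⇒ω≤ : ω≤ G c
  degreeColoring⇒ω≤ H 2≤v = ⌈/⌉≤ (⌊n/2⌋-mono 2≤v) (begin
    ∣ edges ∣                                  ≡⟨ ∣p∣≡count edges ⟩
    count (lookup edges)                       ≤⟨ count-mono edges⇒inside ⟩
    count (lookup (inside G verts))            ≡⟨ ∣p∣≡count (inside G verts) ⟨
    ∣ inside G verts ∣                         ≤⟨ coverCond verts ⟩
    coverBound G c μ verts                     ≡⟨ Σ<≡∑ c _ ⟩
    ∑[ i < c ] ⌊ ∣ tabulate (coloured i) ∣ /2⌋  ≤⟨ ∑-≤-* (λ i → ⌊n/2⌋-mono (coloured≤verts i)) ⟩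
    c * ⌊ ∣ verts ∣ /2⌋                        ∎)
    where
    open SubMultigraph H
    open ≤-Reasoning

    edges⇒inside : ∀ e → lookup edges e ≡ true → lookup (inside G verts) e ≡ true
    edges⇒inside e e∈ = trans (lookup∘tabulate _ e)
      (cong₂ _∧_ ([]=⇒lookup (proj₁ ends∈)) ([]=⇒lookup (proj₂ ends∈)))
      where
      ends∈ : proj₁ (ends e) ∈ verts × proj₂ (ends e) ∈ verts
      ends∈ = closed e (lookup⇒[]= e edges e∈)

    coloured : Fin c → Fin n → Bool
    coloured i x = lookup verts x ∧ lookup (μ x) i

    coloured≤verts : ∀ i → ∣ tabulate (coloured i) ∣ ≤ ∣ verts ∣
    coloured≤verts i = subst₂ _≤_ (sym (∣tabulate∣≡count (coloured i))) (sym (∣p∣≡count verts))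
      (count-mono λ x → ∧-conicalˡ (lookup verts x) (lookup (μ x) i))

mainTheorem1 : (G : Multigraph) (χ' : ℕ) → IsLeast (EdgeColoring G) χ' →
    Σ ℕ (λ τ → IsLeast (DegreeColoring G) τ × (Δ G ≤ τ × ω≤ G τ) × τ ≤ χ')
mainTheorem1 G χ' (ec , _) with least-exists (degreeColoring? G) (edgeColoring⇒degreeColoring ec)
... | τ , least@(dτ , minimal) =
  τ , least , (degreeColoring⇒Δ≤ dτ , degreeColoring⇒ω≤ dτ) , minimal χ' (edgeColoring⇒degreeColoring ec)
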